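{- Let $m$ be a positive integer, $x_1,\dots,x_m\in V$ pairwise distinct, $\varphi_1,\dots,\varphi_m\in E$, and assume $H[x_1:\varphi_1,\dots,x_m:\varphi_m]$; let $k_0=\varepsilon$, $k_i=(x_1,\varphi_1)\|\dots\|(x_i,\varphi_i)$ and $k=k_m$. Let $i\in\{0,\dots,m-1\}$ and $\psi\in E(k_i)$ with $x_j\notin V_b(\psi)$ for every $j=i+1,\dots,m$. Then $\psi\in E(k)$, and for every $\sigma\in\Xi(k)$ there exists $\rho\in\Xi(k_i)$ with $\rho\sqsubseteq\sigma$ and $\#(k,\psi,\sigma)=\#(k_i,\psi,\rho)$.
   Context: Language $(V,F,C,\#)$: variables $V$; constants $C$ with meanings $\#(c)$; operator symbols $F$, each $f$ with applicability condition $A_f(x_1,\dots,x_n)$ and value $P_f(x_1,\dots,x_n)$ when applicable; auxiliary symbols $($, $)$, $,$, $:$, $\{\}$; all disjoint and uniquely readable; expressions are strings. Soops: finite sequences of ordered pairs; $\varepsilon$ empty, $\|$ concatenation; $\mathrm{dom}$ = set of first components; $\alpha(a)=b$; $\alpha\sqsubseteq\gamma$: initial segment. Simultaneous induction on $n\ge1$: $K(1)=\{\varepsilon\}$, $\Xi(\varepsilon)=\{\varepsilon\}$, $E(1,\varepsilon)=C$, $\#(\varepsilon,c,\varepsilon)=\#(c)$, $V_b(c)=V_f(c)=\emptyset$. $K(n)^+$: all $h\|(y,\varphi)$, $h\in K(n)$, $\varphi\in E(n,h)$, $y\in V\setminus\mathrm{dom}(h)$, $\#(h,\varphi,\rho)$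 a set for all $\rho$; $K(n+1)=K(n)\cup K(n)^+$; $\Xi(h\|(y,\varphi))=\{\rho\|(y,s):\rho\in\Xi(h),s\in\#(h,\varphi,\rho)\}$. $E(n+1,k)$ is the union of: (0) $E(n,k)$ if $k\in K(n)$; (a) for $k=h\|(y,\varphi)\in K(n)^+$, $t\in E(n,h)$ with $y\notin V_b(t)$, $\#(k,t,\rho\|(y,s))=\#(h,t,\rho)$; (b) for such $k$, $y$ itself, $\#(k,y,\sigma)=\sigma(y)$, $V_f(y)=\{y\}$, $V_b(y)=\emptyset$; (c) for $k\in K(n)$, $(\varphi)(\varphi_1,\dots,\varphi_m)$ with $\varphi,\varphi_i\in E(n,k)$, $\#(k,\varphi,\sigma)$ an $m$-ary function defined at $(\#(k,\varphi_i,\sigma))_i$ for all $\sigma$, meaning its value, $V_b,V_f$ unions; (d) for $k\in K(n)$, $(f)(\varphi_1,\dots,\varphi_m)$, $f\in F$, $\varphi_i\in E(n,k)$, $A_f(\#(k,\varphi_1,\sigma),\dots)$ for all $\sigma$, meaning $P_f(\dots)$, $V_b,V_f$ unions; (e) for $k\in K(n)$, $\{\}(x_1:\varphi_1,\dots,x_m:\varphi_m,\varphi)$, $x_i$ distinct in $V\setminus\mathrm{dom}(k)$, $k'_i=k\|(x_1,\varphi_1)\|\dots\|(x_i,\varphi_i)\in K(n)$, $\varphi_i\in E(n,k'_{i-1})$ with set meanings, $\varphi\in E(n,k'_m)$; meaning $\{\#(k'_m,\varphi,\sigma'):\sigma'\in\Xi(k'_m),\sigma\sqsubseteq\sigma'\}$;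 $V_b=\{x_1,\dots,x_m\}\cup\bigcup V_b(\varphi_i)\cup V_b(\varphi)$; $V_f=V_f(\varphi_1)\cup(V_f(\varphi_2)\setminus\{x_1\})\cup\dots\cup(V_f(\varphi)\setminus\{x_1,\dots,x_m\})$. $K=\bigcup K(n)$, $E(k)=\bigcup_{n:k\in K(n)}E(n,k)$, $E=\bigcup_kE(k)$. $H[x_1:\varphi_1,\dots,x_m:\varphi_m]$ means: with $k_0=\varepsilon$, $k_i=(x_1,\varphi_1)\|\dots\|(x_i,\varphi_i)$, for each $i=1..m$: $k_{i-1}\in K$, $\varphi_i\in E(k_{i-1})$, and $\#(k_{i-1},\varphi_i,\rho)$ is a set for all $\rho\in\Xi(k_{i-1})$. -}

module Defs where

open import Data.Nat using (ℕ; zero; suc)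
open import Data.List using (List; []; _∷_; _++_; [_]; map)
open import Data.List.Membership.Propositional using (_∈_)
open import Data.List.Relation.Unary.All using (All)
open import Data.List.Relation.Unary.Unique.Propositional using (Unique)
open import Data.List.Relation.Binary.Pointwise using (Pointwise)
open import Data.Product using (Σ; Σ-syntax; _×_; _,_; proj₁; proj₂)
open import Data.Sum using (_⊎_)
open import Data.Empty using (⊥)
open import Data.Unit using (⊤)
open import Relation.Nullary using (¬_)
open import Relation.Binary.PropositionalEquality using (_≡_)

_⇔_ : Set → Set → Set
P ⇔ Q = (P → Q) × (Q → P)

-- The data of a language (V,F,C,#) together with the ambient universe of
-- mathematical objects in which meanings live.
record Lang : Set₁ where
  field
    Var   : Set
    Const : Set
    Op    : Set
    U     : Set
    _∈U_  : U → U → Set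
    IsSet : U → Set
    ext   : ∀ {a b} → IsSet a → IsSet b → (∀ z → (z ∈U a) ⇔ (z ∈U b)) → a ≡ b
    meanC : Const → U
    A     : Op → List U → Set
    P     : (f : Op) (as : List U) → A f as → U
    -- "g is an (length as)-ary function defined at as", and its value there
    FunAt : U → List U → Set
    app   : (g : U) (as : List U) → FunAt g as → U

module Theory (𝓛 : Lang) where
  open Lang 𝓛 public

  -- Expressions, as abstract syntax trees (unique readability).
  data Expr : Set where
    var  : Var → Expr
    con  : Const → Expr
    appE : Expr → List Expr → Expr                 -- (φ)(φ₁,…,φₘ)
    opE  : Op → List Expr → Expr                   -- (f)(φ₁,…,φₘ)
    setE : List (Var × Expr) → Expr → Expr         -- {}(x₁:φ₁,…,xₘ:φₘ,φ)

  Ctx : Set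
  Ctx = List (Var × Expr)

  Asg : Set
  Asg = List (Var × U)

  dom : {B : Set} → List (Var × B) → List Var
  dom = map proj₁

  _⊑_ : Asg → Asg → Set
  σ ⊑ σ' = Σ[ τ ∈ Asg ] σ' ≡ σ ++ τ

  mutual
    Vb : Expr → Var → Set
    Vb (var x) y = ⊥
    Vb (con c) y = ⊥
    Vb (appE φ φs) y = Vb φ y ⊎ VbL φs y
    Vb (opE f φs) y = VbL φs y
    Vb (setE bs φ) y = VbB bs y ⊎ Vb φ y

    VbL : List Expr → Var → Set
    VbL [] y = ⊥
    VbL (φ ∷ φs) y = Vb φ y ⊎ VbL φs y

    VbB : List (Var × Expr) → Var → Set
    VbB [] y = ⊥
    VbB ((x , φ) ∷ bs) y = (y ≡ x) ⊎ Vb φ y ⊎ VbB bs y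

  -- One stage n of the simultaneous inductive definition:
  -- K(n), E(n,·), #(·,·,·) (as a relation "Den k φ σ v" : #(k,φ,σ) = v) and Ξ.
  record Stage : Set₁ where
    field
      K   : Ctx → Set
      E   : Ctx → Expr → Set
      Den : Ctx → Expr → Asg → U → Set
      Xi  : Ctx → Asg → Set

  module _ (L : Stage) where
    open Stage L

    SetMeaning : Ctx → Expr → Asg → Set
    SetMeaning h φ ρ = Σ[ v ∈ U ] (Den h φ ρ v × IsSet v)

    -- conditions for h ∥ (y,φ) ∈ K(n)^+
    KplusAt : Ctx → Var → Expr → Set
    KplusAt h y φ = K h × E h φ × ¬ (y ∈ dom h)
                    × (∀ ρ → Xi h ρ → SetMeaning h φ ρ)

    -- conditions on the binders of a {}-expression (rule (e)), with
    -- accumulated context k'_{i-1}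
    BindOK : Ctx → List (Var × Expr) → Set
    BindOK k [] = ⊤
    BindOK k ((x , φ) ∷ bs) =
      K (k ++ [ (x , φ) ]) × E k φ × (∀ ρ → Xi k ρ → SetMeaning k φ ρ)
      × BindOK (k ++ [ (x , φ) ]) bs

    DenL : Ctx → List Expr → Asg → List U → Set
    DenL k φs σ as = Pointwise (λ φ a → Den k φ σ a) φs as

    step : Stage
    step = record { K = K' ; E = E' ; Den = Den' ; Xi = Xi' }
      where
      K' : Ctx → Set
      K' k = K k ⊎ (Σ[ h ∈ Ctx ] Σ[ y ∈ Var ] Σ[ φ ∈ Expr ]
                      (k ≡ h ++ [ (y , φ) ] × KplusAt h y φ))

      AppOK : Ctx → Expr → List Expr → Set
      AppOK k φ φs = ∀ σ → Xi k σ → Σ[ g ∈ U ] Σ[ as ∈ List U ]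
                       (Den k φ σ g × DenL k φs σ as × FunAt g as)
      OpOK : Ctx → Op → List Expr → Set
      OpOK k f φs = ∀ σ → Xi k σ → Σ[ as ∈ List U ] (DenL k φs σ as × A f as)
      SetOK : Ctx → List (Var × Expr) → Expr → Set
      SetOK k bs φ = Unique (dom bs) × All (λ x → ¬ (x ∈ dom k)) (dom bs)
                     × BindOK k bs × E (k ++ bs) φ

      E' : Ctx → Expr → Set
      E' k ψ =
        -- (0)
        (K k × E k ψ)
        -- (a)
        ⊎ (Σ[ h ∈ Ctx ] Σ[ y ∈ Var ] Σ[ φ ∈ Expr ]
             (k ≡ h ++ [ (y , φ) ] × KplusAt h y φ × E h ψ × ¬ Vb ψ y))
        -- (b)
        ⊎ (Σ[ h ∈ Ctx ] Σ[ y ∈ Var ] Σ[ φ ∈ Expr ]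
             (k ≡ h ++ [ (y , φ) ] × KplusAt h y φ × ψ ≡ var y))
        -- (c)
        ⊎ (Σ[ φ ∈ Expr ] Σ[ φs ∈ List Expr ]
             (ψ ≡ appE φ φs × K k × E k φ × All (E k) φs × AppOK k φ φs))
        -- (d)
        ⊎ (Σ[ f ∈ Op ] Σ[ φs ∈ List Expr ]
             (ψ ≡ opE f φs × K k × All (E k) φs × OpOK k f φs))
        -- (e)
        ⊎ (Σ[ bs ∈ List (Var × Expr) ] Σ[ φ ∈ Expr ]
             (ψ ≡ setE bs φ × K k × SetOK k bs φ))

      Den' : Ctx → Expr → Asg → U → Set
      Den' k ψ σ v =
        -- (0)
        (K k × E k ψ × Den k ψ σ v)
        -- (a): #(h∥(y,φ), t, ρ∥(y,s)) = #(h,t,ρ)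
        ⊎ (Σ[ h ∈ Ctx ] Σ[ y ∈ Var ] Σ[ φ ∈ Expr ] Σ[ ρ ∈ Asg ] Σ[ s ∈ U ]
             (k ≡ h ++ [ (y , φ) ] × KplusAt h y φ × E h ψ × ¬ Vb ψ y
              × σ ≡ ρ ++ [ (y , s) ] × Den h ψ ρ v))
        -- (b): #(k,y,σ) = σ(y)
        ⊎ (Σ[ h ∈ Ctx ] Σ[ y ∈ Var ] Σ[ φ ∈ Expr ]
             (k ≡ h ++ [ (y , φ) ] × KplusAt h y φ × ψ ≡ var y
              × (y , v) ∈ σ))
        -- (c)
        ⊎ (Σ[ φ ∈ Expr ] Σ[ φs ∈ List Expr ]
             (ψ ≡ appE φ φs × K k × E k φ × All (E k) φs × AppOK k φ φs
              × Σ[ g ∈ U ] Σ[ as ∈ List U ] Σ[ d ∈ FunAt g as ]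
                  (Den k φ σ g × DenL k φs σ as × v ≡ app g as d)))
        -- (d)
        ⊎ (Σ[ f ∈ Op ] Σ[ φs ∈ List Expr ]
             (ψ ≡ opE f φs × K k × All (E k) φs × OpOK k f φs
              × Σ[ as ∈ List U ] Σ[ a ∈ A f as ]
                  (DenL k φs σ as × v ≡ P f as a)))
        -- (e): v = {#(k'_m,φ,σ') : σ' ∈ Ξ(k'_m), σ ⊑ σ'}
        ⊎ (Σ[ bs ∈ List (Var × Expr) ] Σ[ φ ∈ Expr ]
             (ψ ≡ setE bs φ × K k × SetOK k bs φ
              × IsSet v
              × (∀ z → (z ∈U v) ⇔ (Σ[ σ' ∈ Asg ]
                          (Xi (k ++ bs) σ' × σ ⊑ σ' × Den (k ++ bs) φ σ' z)))))

      Xi' : Ctx → Asg → Set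
      Xi' k σ =
        (K k × Xi k σ)
        ⊎ (Σ[ h ∈ Ctx ] Σ[ y ∈ Var ] Σ[ φ ∈ Expr ] Σ[ ρ ∈ Asg ] Σ[ s ∈ U ]
             Σ[ S ∈ U ]
             (k ≡ h ++ [ (y , φ) ] × KplusAt h y φ × Xi h ρ
              × Den h φ ρ S × s ∈U S × σ ≡ ρ ++ [ (y , s) ]))

  stage₁ : Stage
  stage₁ = record
    { K   = λ k → k ≡ []
    ; E   = λ k φ → k ≡ [] × Σ[ c ∈ Const ] φ ≡ con c
    ; Den = λ k φ σ v → k ≡ [] × σ ≡ [] × Σ[ c ∈ Const ] (φ ≡ con c × v ≡ meanC c)
    ; Xi  = λ k σ → k ≡ [] × σ ≡ []
    }

  -- stage n is the paper's stage n+1 (paper's numbering starts at 1):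
  -- stage 0 = (K(1),E(1,·),…), stage (suc n) = step (stage n)
  stage : ℕ → Stage
  stage zero = stage₁
  stage (suc n) = step (stage n)

  𝐊 : Ctx → Set
  𝐊 k = Σ[ n ∈ ℕ ] Stage.K (stage n) k

  𝐄 : Ctx → Expr → Set
  𝐄 k φ = Σ[ n ∈ ℕ ] (Stage.K (stage n) k × Stage.E (stage n) k φ)

  𝐄all : Expr → Set
  𝐄all φ = Σ[ k ∈ Ctx ] 𝐄 k φ

  Ξ : Ctx → Asg → Set
  Ξ k σ = Σ[ n ∈ ℕ ] (Stage.K (stage n) k × Stage.Xi (stage n) k σ)

  Mean : Ctx → Expr → Asg → U → Set
  Mean k φ σ v = Σ[ n ∈ ℕ ] (Stage.K (stage n) k × Stage.E (stage n) k φ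
                             × Stage.Den (stage n) k φ σ v)

  Hfrom : Ctx → List (Var × Expr) → Set
  Hfrom k [] = ⊤
  Hfrom k ((x , φ) ∷ bs) =
    𝐊 k × 𝐄 k φ
    × (∀ ρ → Ξ k ρ → Σ[ v ∈ U ] (Mean k φ ρ v × IsSet v))
    × Hfrom (k ++ [ (x , φ) ]) bs

  H : List (Var × Expr) → Set
  H bs = Hfrom [] bs

module Submission where

-- The stages of the simultaneous inductive definition compute meanings by
-- stage-dependent rules, but all of them agree with one stage-free semantics:
-- `Sem ψ σ v` (v is the value of ψ under σ, by structural recursion on ψ) and
-- `Extends ρ bs σ` (σ assigns the binders bs one after the other, each to an
-- element of its declared set).  The coherence theorem `coherent` shows by
-- induction on the stage that Ξ(k) is `Extends [] k` and #(k,ψ,σ) is `Sem ψ σ`.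
--
-- Against this semantics the lemma is a statement about assignments: every
-- σ ∈ Ξ(pre ++ post) splits as ρ ++ t with ρ ∈ Ξ(pre) (`extends-++`); the
-- variables of t are the binders of post, which do not occur in ψ since they
-- are neither declared in pre nor bound in ψ (`occurs-declared`); and `Sem` does
-- not see variables that do not occur (`sem-skip`).  Membership ψ ∈ E(pre ++ post)
-- comes from applying rule (a) once per binder of post (`E-weaken`).  Both parts
-- are proved for an arbitrary split pre ++ post (`weaken`); the lemma is the
-- split at position i.

open import Defs
open import Data.Nat using (ℕ; _<_; _≤_; zero; suc; _⊔_; _≤′_; ≤′-step; ≤′-reflexive)
open import Data.Nat.Properties using (≤⇒≤′; m≤m⊔n; m≤n⊔m; suc-injective)
open import Data.List using (List; length; take; drop; map; []; _∷_; _++_; [_])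
open import Data.List.Properties
  using (++-assoc; ++-identityʳ; map-++; length-map; ∷ʳ-injective; ∷-injective; take++drop≡id)
open import Data.List.Membership.Propositional using (_∈_)
open import Data.List.Membership.Propositional.Properties
  using (∈-map⁺; ∈-map⁻; ∈-++⁺ˡ; ∈-++⁺ʳ; ∈-++⁻)
open import Data.List.Relation.Unary.All as All using (All; []; _∷_)
open import Data.List.Relation.Unary.Any using (here; there)
open import Data.List.Relation.Unary.AllPairs using (_∷_)
open import Data.List.Relation.Unary.Unique.Propositional using (Unique)
open import Data.List.Relation.Binary.Pointwise using ([]; _∷_)
open import Data.Product using (Σ; Σ-syntax; _×_; _,_; proj₁; proj₂)
open import Data.Sum using (_⊎_; inj₁; inj₂; [_,_]′; map₁; map₂)
open import Data.Empty using (⊥; ⊥-elim)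
open import Data.Unit using (⊤; tt)
open import Function using (_∘_)
open import Relation.Nullary using (¬_)
open import Relation.Binary.PropositionalEquality using (_≡_; refl; sym; trans; cong; subst; subst₂)

⇔-refl : {P : Set} → P ⇔ P
⇔-refl = (λ p → p) , (λ p → p)

⇔-sym : {P Q : Set} → P ⇔ Q → Q ⇔ P
⇔-sym (f , g) = g , f

⇔-trans : {P Q R : Set} → P ⇔ Q → Q ⇔ R → P ⇔ R
⇔-trans (f , g) (h , k) = h ∘ f , g ∘ k

×-cong-⇔ : {P P' Q Q' : Set} → P ⇔ P' → Q ⇔ Q' → (P × Q) ⇔ (P' × Q')
×-cong-⇔ (f , f') (g , g') = (λ (p , q) → f p , g q) , (λ (p , q) → f' p , g' q)

Σ-cong-⇔ : {A : Set} {P Q : A → Set} → (∀ a → P a ⇔ Q a) → Σ A P ⇔ Σ A Q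
Σ-cong-⇔ e = (λ (a , p) → a , proj₁ (e a) p) , (λ (a , q) → a , proj₂ (e a) q)

Π-cong-⇔ : {A : Set} {P Q : A → Set} → (∀ a → P a ⇔ Q a) → (∀ a → P a) ⇔ (∀ a → Q a)
Π-cong-⇔ e = (λ p a → proj₁ (e a) (p a)) , (λ q a → proj₂ (e a) (q a))

⇔-congʳ : {P Q R : Set} → Q ⇔ R → (P ⇔ Q) ⇔ (P ⇔ R)
⇔-congʳ e = (λ pq → ⇔-trans pq e) , (λ pr → ⇔-trans pr (⇔-sym e))

++-cancel-length : {A : Set} (a c : List A) {b d : List A} →
                   a ++ b ≡ c ++ d → length a ≡ length c → a ≡ c × b ≡ d
++-cancel-length []      []      e _ = refl , e
++-cancel-length (x ∷ a) (y ∷ c) e l with ∷-injective e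
... | refl , e' with ++-cancel-length a c e' (suc-injective l)
...   | refl , e'' = refl , e''

unique-++-disjoint : {A : Set} (xs : List A) {ys : List A} {y : A} →
                     Unique (xs ++ ys) → y ∈ xs → y ∈ ys → ⊥
unique-++-disjoint (a ∷ xs) (a∉ ∷ _) (here refl) y∈ys = All.lookup a∉ (∈-++⁺ʳ xs y∈ys) refl
unique-++-disjoint (a ∷ xs) (_ ∷ u)  (there y∈xs) y∈ys = unique-++-disjoint xs u y∈xs y∈ys

module Weakening (𝓛 : Lang) where
  open Theory 𝓛

  -- The stage-free semantics.  `Sem ψ σ v`: v is the meaning of ψ under σ,
  -- a variable meaning any value bound to it in σ.  `Extends ρ bs t`: the
  -- assignment t gives the binders bs, in order, values in their declared
  -- sets, each set being evaluated under ρ extended by the earlier values.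
  mutual
    Sem : Expr → Asg → U → Set
    Sem (var x) σ v = (x , v) ∈ σ
    Sem (con c) σ v = v ≡ meanC c
    Sem (appE φ φs) σ v = Σ[ g ∈ U ] Σ[ as ∈ List U ] Σ[ d ∈ FunAt g as ]
                            (Sem φ σ g × SemList φs σ as × v ≡ app g as d)
    Sem (opE f φs) σ v = Σ[ as ∈ List U ] Σ[ a ∈ A f as ] (SemList φs σ as × v ≡ P f as a)
    Sem (setE bs φ) σ v =
      IsSet v × (∀ z → (z ∈U v) ⇔ (Σ[ t ∈ Asg ] (Extends σ bs t × Sem φ (σ ++ t) z)))

    SemList : List Expr → Asg → List U → Set
    SemList []       σ []       = ⊤
    SemList []       σ (_ ∷ _)  = ⊥
    SemList (_ ∷ _)  σ []       = ⊥
    SemList (φ ∷ φs) σ (a ∷ as) = Sem φ σ a × SemList φs σ as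

    Extends : Asg → List (Var × Expr) → Asg → Set
    Extends ρ [] t = t ≡ []
    Extends ρ ((y , φ) ∷ bs) t = Σ[ S ∈ U ] Σ[ s ∈ U ] Σ[ t' ∈ Asg ]
      (Sem φ ρ S × s ∈U S × t ≡ (y , s) ∷ t' × Extends (ρ ++ [ (y , s) ]) bs t')

  -- Occurrences of variables in expression positions (binder names are not
  -- occurrences); these are the variables `Sem` may look up.
  mutual
    Occurs : Expr → Var → Set
    Occurs (var x) y = y ≡ x
    Occurs (con c) y = ⊥
    Occurs (appE φ φs) y = Occurs φ y ⊎ OccursList φs y
    Occurs (opE f φs) y = OccursList φs y
    Occurs (setE bs φ) y = OccursBinders bs y ⊎ Occurs φ y

    OccursList : List Expr → Var → Set
    OccursList [] y = ⊥
    OccursList (φ ∷ φs) y = Occurs φ y ⊎ OccursList φs y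

    OccursBinders : List (Var × Expr) → Var → Set
    OccursBinders [] y = ⊥
    OccursBinders ((x , φ) ∷ bs) y = Occurs φ y ⊎ OccursBinders bs y

  Avoids : (Var → Set) → Asg → Set
  Avoids O b = ∀ y → O y → ¬ y ∈ dom b

  dom-++ : (h r : Ctx) → dom (h ++ r) ≡ dom h ++ dom r
  dom-++ = map-++ proj₁

  ∈-dom-++ˡ : ∀ {y} (h r : Ctx) → y ∈ dom h → y ∈ dom (h ++ r)
  ∈-dom-++ˡ h r m = subst (_ ∈_) (sym (dom-++ h r)) (∈-++⁺ˡ m)

  ∈-dom-++ʳ : ∀ {y} (h r : Ctx) → y ∈ dom r → y ∈ dom (h ++ r)
  ∈-dom-++ʳ h r m = subst (_ ∈_) (sym (dom-++ h r)) (∈-++⁺ʳ (dom h) m)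

  ∈-dom-++⁻ : ∀ {y} (h r : Ctx) → y ∈ dom (h ++ r) → y ∈ dom h ⊎ y ∈ dom r
  ∈-dom-++⁻ h r m = ∈-++⁻ (dom h) (subst (_ ∈_) (dom-++ h r) m)

  ∈-skip : ∀ {x v} (a b c : Asg) → ¬ x ∈ dom b → ((x , v) ∈ a ++ b ++ c) ⇔ ((x , v) ∈ a ++ c)
  ∈-skip {x} {v} a b c x∉b = skip , keep
    where
    skip : (x , v) ∈ a ++ b ++ c → (x , v) ∈ a ++ c
    skip m with ∈-++⁻ a m
    ... | inj₁ m∈a = ∈-++⁺ˡ m∈a
    ... | inj₂ m' with ∈-++⁻ b m'
    ...   | inj₁ m∈b = ⊥-elim (x∉b (∈-map⁺ proj₁ m∈b))
    ...   | inj₂ m∈c = ∈-++⁺ʳ a m∈c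
    keep : (x , v) ∈ a ++ c → (x , v) ∈ a ++ b ++ c
    keep m with ∈-++⁻ a m
    ... | inj₁ m∈a = ∈-++⁺ˡ m∈a
    ... | inj₂ m∈c = ∈-++⁺ʳ a (∈-++⁺ʳ b m∈c)

  -- The `-under` variants allow a tail t after
  -- the block, which is where binders of a comprehension put their values.
  mutual
    sem-skip : ∀ ψ (a b c : Asg) {v} → Avoids (Occurs ψ) b →
               Sem ψ (a ++ b ++ c) v ⇔ Sem ψ (a ++ c) v
    sem-skip (var x) a b c avoid = ∈-skip a b c (avoid x refl)
    sem-skip (con _) a b c avoid = ⇔-refl
    sem-skip (appE φ φs) a b c avoid =
      Σ-cong-⇔ λ g → Σ-cong-⇔ λ as → Σ-cong-⇔ λ d →
        ×-cong-⇔ (sem-skip φ a b c (λ y → avoid y ∘ inj₁))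
                 (×-cong-⇔ (semList-skip φs a b c (λ y → avoid y ∘ inj₂)) ⇔-refl)
    sem-skip (opE f φs) a b c avoid =
      Σ-cong-⇔ λ as → Σ-cong-⇔ λ p → ×-cong-⇔ (semList-skip φs a b c avoid) ⇔-refl
    sem-skip (setE bs φ) a b c avoid =
      ×-cong-⇔ ⇔-refl (Π-cong-⇔ λ z → ⇔-congʳ (Σ-cong-⇔ λ t →
        ×-cong-⇔ (extends-skip bs a b c (λ y → avoid y ∘ inj₁))
                 (sem-skip-under φ a b c t (λ y → avoid y ∘ inj₂))))

    sem-skip-under : ∀ ψ (a b c t : Asg) {v} → Avoids (Occurs ψ) b →
                     Sem ψ ((a ++ b ++ c) ++ t) v ⇔ Sem ψ ((a ++ c) ++ t) v
    sem-skip-under ψ a b c t avoid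
      rewrite ++-assoc a (b ++ c) t | ++-assoc b c t | ++-assoc a c t =
      sem-skip ψ a b (c ++ t) avoid

    semList-skip : ∀ φs (a b c : Asg) {as} → Avoids (OccursList φs) b →
                   SemList φs (a ++ b ++ c) as ⇔ SemList φs (a ++ c) as
    semList-skip []       a b c {[]}    avoid = ⇔-refl
    semList-skip []       a b c {_ ∷ _} avoid = ⇔-refl
    semList-skip (φ ∷ φs) a b c {[]}    avoid = ⇔-refl
    semList-skip (φ ∷ φs) a b c {_ ∷ _} avoid =
      ×-cong-⇔ (sem-skip φ a b c (λ y → avoid y ∘ inj₁))
               (semList-skip φs a b c (λ y → avoid y ∘ inj₂))

    extends-skip : ∀ bs (a b c : Asg) {t} → Avoids (OccursBinders bs) b →
                   Extends (a ++ b ++ c) bs t ⇔ Extends (a ++ c) bs t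
    extends-skip [] a b c avoid = ⇔-refl
    extends-skip ((y , φ) ∷ bs) a b c avoid =
      Σ-cong-⇔ λ S → Σ-cong-⇔ λ s → Σ-cong-⇔ λ t' →
        ×-cong-⇔ (sem-skip φ a b c (λ y → avoid y ∘ inj₁))
          (×-cong-⇔ ⇔-refl (×-cong-⇔ ⇔-refl
            (extends-skip-under bs a b c [ (y , s) ] (λ y → avoid y ∘ inj₂))))

    extends-skip-under : ∀ bs (a b c t : Asg) {t'} → Avoids (OccursBinders bs) b →
                         Extends ((a ++ b ++ c) ++ t) bs t' ⇔ Extends ((a ++ c) ++ t) bs t'
    extends-skip-under bs a b c t avoid
      rewrite ++-assoc a (b ++ c) t | ++-assoc b c t | ++-assoc a c t =
      extends-skip bs a b (c ++ t) avoid

  sem-drop-suffix : ∀ ψ (a b : Asg) {v} → Avoids (Occurs ψ) b → Sem ψ (a ++ b) v ⇔ Sem ψ a v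
  sem-drop-suffix ψ a b {v} avoid =
    subst₂ (λ l r → Sem ψ l v ⇔ Sem ψ r v) (cong (a ++_) (++-identityʳ b)) (++-identityʳ a)
      (sem-skip ψ a b [] avoid)

  extends-dom : ∀ {ρ} bs {t} → Extends ρ bs t → dom t ≡ dom bs
  extends-dom [] refl = refl
  extends-dom ((y , φ) ∷ bs) (_ , _ , _ , _ , _ , refl , e) = cong (y ∷_) (extends-dom bs e)

  extends-length : ∀ {ρ} bs {t} → Extends ρ bs t → length t ≡ length bs
  extends-length bs {t} e =
    trans (sym (length-map proj₁ t)) (trans (cong length (extends-dom bs e)) (length-map proj₁ bs))

  extends-++ : ∀ ρ k bs σ' → Extends ρ (k ++ bs) σ' ⇔
               (Σ[ σ₁ ∈ Asg ] Σ[ t ∈ Asg ]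
                  (Extends ρ k σ₁ × Extends (ρ ++ σ₁) bs t × σ' ≡ σ₁ ++ t))
  extends-++ ρ [] bs σ' =
    (λ e → [] , σ' , refl , subst (λ r → Extends r bs σ') (sym (++-identityʳ ρ)) e , refl) ,
    (λ { (.[] , t , refl , e , refl) → subst (λ r → Extends r bs t) (++-identityʳ ρ) e })
  extends-++ ρ ((y , φ) ∷ k) bs σ' = split σ' , join σ'
    where
    Split : Asg → Set
    Split σ' = Σ[ σ₁ ∈ Asg ] Σ[ t ∈ Asg ]
                 (Extends ρ ((y , φ) ∷ k) σ₁ × Extends (ρ ++ σ₁) bs t × σ' ≡ σ₁ ++ t)
    reassoc : ∀ s σ₁ → ρ ++ [ (y , s) ] ++ σ₁ ≡ (ρ ++ [ (y , s) ]) ++ σ₁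
    reassoc s σ₁ = sym (++-assoc ρ [ (y , s) ] σ₁)
    split : ∀ σ' → Extends ρ ((y , φ) ∷ k ++ bs) σ' → Split σ'
    split .((y , s) ∷ t') (S , s , t' , sm , s∈S , refl , e)
      with proj₁ (extends-++ (ρ ++ [ (y , s) ]) k bs t') e
    ... | σ₁ , t , e₁ , e₂ , refl =
      (y , s) ∷ σ₁ , t , (S , s , σ₁ , sm , s∈S , refl , e₁) ,
      subst (λ r → Extends r bs t) (sym (reassoc s σ₁)) e₂ , refl
    join : ∀ σ' → Split σ' → Extends ρ ((y , φ) ∷ k ++ bs) σ'
    join .(((y , s) ∷ σ₁) ++ t) (.((y , s) ∷ σ₁) , t , (S , s , σ₁ , sm , s∈S , refl , e₁) , e₂ , refl) =
      S , s , σ₁ ++ t , sm , s∈S , refl ,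
      proj₂ (extends-++ (ρ ++ [ (y , s) ]) k bs (σ₁ ++ t))
        (σ₁ , t , e₁ , subst (λ r → Extends r bs t) (reassoc s σ₁) e₂ , refl)

  extends-snoc⁻ : ∀ h {y φ σ} → Extends [] (h ++ [ (y , φ) ]) σ →
                  Σ[ ρ ∈ Asg ] Σ[ s ∈ U ] Σ[ S ∈ U ]
                    (Extends [] h ρ × Sem φ ρ S × s ∈U S × σ ≡ ρ ++ [ (y , s) ])
  extends-snoc⁻ h {σ = σ} e with proj₁ (extends-++ [] h _ σ) e
  ... | ρ , _ , eh , (S , s , _ , sm , s∈S , refl , refl) , refl = ρ , s , S , eh , sm , s∈S , refl

  extends-snoc⁺ : ∀ h {y φ ρ s S} → Extends [] h ρ → Sem φ ρ S → s ∈U S →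
                  Extends [] (h ++ [ (y , φ) ]) (ρ ++ [ (y , s) ])
  extends-snoc⁺ h {y} {φ} {ρ} {s} {S} eh sm s∈S =
    proj₂ (extends-++ [] h [ (y , φ) ] _) (ρ , [ (y , s) ] , eh , (S , s , [] , sm , s∈S , refl , refl) , refl)

  Kn : ℕ → Ctx → Set
  Kn n = Stage.K (stage n)

  En : ℕ → Ctx → Expr → Set
  En n = Stage.E (stage n)

  Dn : ℕ → Ctx → Expr → Asg → U → Set
  Dn n = Stage.Den (stage n)

  Xn : ℕ → Ctx → Asg → Set
  Xn n = Stage.Xi (stage n)

  binders-bound : ∀ {y} bs → y ∈ dom bs → VbB bs y
  binders-bound ((x , φ) ∷ bs) (here e)  = inj₁ e
  binders-bound ((x , φ) ∷ bs) (there m) = inj₂ (inj₂ (binders-bound bs m))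

  mutual
    occurs-declared : ∀ n {k ψ y} → En n k ψ → Occurs ψ y → y ∈ dom k ⊎ Vb ψ y
    occurs-declared zero (refl , c , refl) ()
    occurs-declared (suc n) (inj₁ (_ , E)) o = occurs-declared n E o
    occurs-declared (suc n) (inj₂ (inj₁ (h , _ , _ , refl , _ , E , _))) o =
      map₁ (∈-dom-++ˡ h _) (occurs-declared n E o)
    occurs-declared (suc n) (inj₂ (inj₂ (inj₁ (h , _ , _ , refl , _ , refl)))) o =
      inj₁ (∈-dom-++ʳ h _ (here o))
    occurs-declared (suc n) (inj₂ (inj₂ (inj₂ (inj₁ (_ , _ , refl , _ , Eφ , _ , _))))) (inj₁ o) =
      map₂ inj₁ (occurs-declared n Eφ o)
    occurs-declared (suc n) (inj₂ (inj₂ (inj₂ (inj₁ (_ , _ , refl , _ , _ , Eφs , _))))) (inj₂ o) =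
      map₂ inj₂ (occursList-declared n Eφs o)
    occurs-declared (suc n) (inj₂ (inj₂ (inj₂ (inj₂ (inj₁ (_ , _ , refl , _ , Eφs , _)))))) o =
      occursList-declared n Eφs o
    occurs-declared (suc n) {k} (inj₂ (inj₂ (inj₂ (inj₂ (inj₂ (bs , _ , refl , _ , (_ , _ , ok , _))))))) (inj₁ o) =
      map₂ inj₁ (occursBinders-declared n k bs ok o)
    occurs-declared (suc n) {k} (inj₂ (inj₂ (inj₂ (inj₂ (inj₂ (bs , _ , refl , _ , (_ , _ , _ , Eφ))))))) (inj₂ o)
      with occurs-declared n Eφ o
    ... | inj₂ vb = inj₂ (inj₂ vb)
    ... | inj₁ m = map₂ (inj₁ ∘ binders-bound bs) (∈-dom-++⁻ k bs m)

    occursList-declared : ∀ n {k φs y} → All (En n k) φs → OccursList φs y → y ∈ dom k ⊎ VbL φs y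
    occursList-declared n (E ∷ _)  (inj₁ o) = map₂ inj₁ (occurs-declared n E o)
    occursList-declared n (_ ∷ Es) (inj₂ o) = map₂ inj₂ (occursList-declared n Es o)

    occursBinders-declared : ∀ n k bs {y} → BindOK (stage n) k bs → OccursBinders bs y →
                             y ∈ dom k ⊎ VbB bs y
    occursBinders-declared n k ((x , φ) ∷ bs) (_ , Eφ , _ , _) (inj₁ o) =
      map₂ (inj₂ ∘ inj₁) (occurs-declared n Eφ o)
    occursBinders-declared n k ((x , φ) ∷ bs) (_ , _ , _ , ok) (inj₂ o)
      with occursBinders-declared n (k ++ [ (x , φ) ]) bs ok o
    ... | inj₂ vb = inj₂ (inj₂ (inj₂ vb))
    ... | inj₁ m with ∈-dom-++⁻ k _ m
    ...   | inj₁ m∈k      = inj₁ m∈k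
    ...   | inj₂ (here e) = inj₂ (inj₁ e)

  binders-context : ∀ n k bs → Kn n k → BindOK (stage n) k bs → Kn n (k ++ bs)
  binders-context n k [] Kk _ = subst (Kn n) (sym (++-identityʳ k)) Kk
  binders-context n k ((x , φ) ∷ bs) _ (Kx , _ , _ , ok) =
    subst (Kn n) (++-assoc k [ (x , φ) ] bs) (binders-context n (k ++ [ (x , φ) ]) bs Kx ok)

  fresh-last : ∀ n {h y ψ} (s : U) → ¬ y ∈ dom h → En n h ψ → ¬ Vb ψ y →
               Avoids (Occurs ψ) [ (y , s) ]
  fresh-last n s y∉h Eψ y∉Vb y o (here refl) = [ y∉h , y∉Vb ]′ (occurs-declared n Eψ o)

  record Coherent (n : ℕ) : Set where
    field
      xi  : ∀ k σ → Kn n k → Xn n k σ ⇔ Extends [] k σ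
      den : ∀ k ψ σ v → Kn n k → En n k ψ → Xn n k σ → Dn n k ψ σ v ⇔ Sem ψ σ v
  open Coherent

  module Step (n : ℕ) (c : Coherent n) where
    xi-sound : ∀ {k σ} → Xn (suc n) k σ → Extends [] k σ
    xi-sound {k} {σ} (inj₁ (Kk , X)) = proj₁ (xi c k σ Kk) X
    xi-sound (inj₂ (h , y , φ , ρ , s , S , refl , (Kh , Eφ , _ , _) , Xh , D , s∈S , refl)) =
      extends-snoc⁺ h (proj₁ (xi c h ρ Kh) Xh) (proj₁ (den c h φ ρ S Kh Eφ Xh) D) s∈S

    xi-complete : ∀ k σ → Kn (suc n) k → Extends [] k σ → Xn (suc n) k σ
    xi-complete k σ (inj₁ Kk) e = inj₁ (Kk , proj₂ (xi c k σ Kk) e)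
    xi-complete .(h ++ [ (y , φ) ]) σ (inj₂ (h , y , φ , refl , ext@(Kh , Eφ , _ , _))) e
      with extends-snoc⁻ h e
    ... | ρ , s , S , eh , sm , s∈S , refl =
      inj₂ (h , y , φ , ρ , s , S , refl , ext , Xh , proj₂ (den c h φ ρ S Kh Eφ Xh) sm , s∈S , refl)
      where Xh = proj₂ (xi c h ρ Kh) eh

    xi-down : ∀ {k σ} → Kn n k → Xn (suc n) k σ → Xn n k σ
    xi-down {k} {σ} Kk X = proj₂ (xi c k σ Kk) (xi-sound X)

    denList-coherent : ∀ {k σ} → Kn n k → Xn n k σ → ∀ φs as → All (En n k) φs →
                       DenL (stage n) k φs σ as ⇔ SemList φs σ as
    denList-coherent {k} {σ} Kk X = go
      where
      go : ∀ φs as → All (En n k) φs → DenL (stage n) k φs σ as ⇔ SemList φs σ as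
      go []       []       _  = (λ _ → tt) , (λ _ → [])
      go []       (_ ∷ _)  _  = (λ ()) , (λ ())
      go (_ ∷ _)  []       _  = (λ ()) , (λ ())
      go (φ ∷ φs) (a ∷ as) (Eφ ∷ Es) =
        (λ { (d ∷ ds) → proj₁ (den c k φ σ a Kk Eφ X) d , proj₁ (go φs as Es) ds }) ,
        (λ { (s , ss) → proj₂ (den c k φ σ a Kk Eφ X) s ∷ proj₂ (go φs as Es) ss })

    comprehension-coherent : ∀ k bs φ σ z → Kn n (k ++ bs) → En n (k ++ bs) φ → Extends [] k σ →
      (Σ[ σ' ∈ Asg ] (Xn n (k ++ bs) σ' × σ ⊑ σ' × Dn n (k ++ bs) φ σ' z)) ⇔
      (Σ[ t ∈ Asg ] (Extends σ bs t × Sem φ (σ ++ t) z))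
    comprehension-coherent k bs φ σ z KB EB eσ = restrict , extend
      where
      restrict : (Σ[ σ' ∈ Asg ] (Xn n (k ++ bs) σ' × σ ⊑ σ' × Dn n (k ++ bs) φ σ' z)) →
                 (Σ[ t ∈ Asg ] (Extends σ bs t × Sem φ (σ ++ t) z))
      restrict (σ' , X' , (τ , σ'≡) , D) with proj₁ (extends-++ [] k bs σ') (proj₁ (xi c (k ++ bs) σ' KB) X')
      ... | σ₁ , t , e₁ , et , σ'≡′
        with ++-cancel-length σ₁ σ (trans (sym σ'≡′) σ'≡)
               (trans (extends-length k e₁) (sym (extends-length k eσ)))
      ...   | refl , refl = t , et , subst (λ r → Sem φ r z) σ'≡′ (proj₁ (den c (k ++ bs) φ σ' z KB EB X') D)
      extend : (Σ[ t ∈ Asg ] (Extends σ bs t × Sem φ (σ ++ t) z)) →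
               (Σ[ σ' ∈ Asg ] (Xn n (k ++ bs) σ' × σ ⊑ σ' × Dn n (k ++ bs) φ σ' z))
      extend (t , et , sm) = σ ++ t , X' , (t , refl) , proj₂ (den c (k ++ bs) φ (σ ++ t) z KB EB X') sm
        where
        X' = proj₂ (xi c (k ++ bs) (σ ++ t) KB) (proj₂ (extends-++ [] k bs (σ ++ t)) (σ , t , eσ , et , refl))

    den-sound : ∀ k ψ σ v → Xn (suc n) k σ → Dn (suc n) k ψ σ v → Sem ψ σ v
    den-sound k ψ σ v X (inj₁ (Kk , Eψ , D)) = proj₁ (den c k ψ σ v Kk Eψ (xi-down Kk X)) D
    den-sound .(h ++ [ (y , φ) ]) ψ .(ρ ++ [ (y , s) ]) v X
              (inj₂ (inj₁ (h , y , φ , ρ , s , refl , (Kh , _ , y∉h , _) , Eψ , y∉Vb , refl , D)))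
      with extends-snoc⁻ h (xi-sound X)
    ... | ρ' , _ , _ , eh , _ , _ , ρ++≡ with ∷ʳ-injective ρ ρ' ρ++≡
    ...   | refl , _ =
      proj₂ (sem-drop-suffix ψ ρ [ (y , s) ] (fresh-last n s y∉h Eψ y∉Vb))
        (proj₁ (den c h ψ ρ v Kh Eψ (proj₂ (xi c h ρ Kh) eh)) D)
    den-sound k ψ σ v X (inj₂ (inj₂ (inj₁ (_ , _ , _ , refl , _ , refl , y∈σ)))) = y∈σ
    den-sound k ψ σ v X
              (inj₂ (inj₂ (inj₂ (inj₁ (φ , φs , refl , Kk , Eφ , Es , _ , g , as , d , Dφ , Ds , refl))))) =
      g , as , d , proj₁ (den c k φ σ g Kk Eφ Xk) Dφ , proj₁ (denList-coherent Kk Xk φs as Es) Ds , refl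
      where Xk = xi-down Kk X
    den-sound k ψ σ v X
              (inj₂ (inj₂ (inj₂ (inj₂ (inj₁ (f , φs , refl , Kk , Es , _ , as , a , Ds , refl)))))) =
      as , a , proj₁ (denList-coherent Kk (xi-down Kk X) φs as Es) Ds , refl
    den-sound k ψ σ v X
              (inj₂ (inj₂ (inj₂ (inj₂ (inj₂ (bs , φ , refl , Kk , (_ , _ , ok , Eφ) , isSet , members)))))) =
      isSet , λ z → ⇔-trans (members z)
        (comprehension-coherent k bs φ σ z (binders-context n k bs Kk ok) Eφ (xi-sound X))

    den-complete : ∀ k ψ σ v → En (suc n) k ψ → Xn (suc n) k σ → Sem ψ σ v → Dn (suc n) k ψ σ v
    den-complete k ψ σ v (inj₁ (Kk , Eψ)) X sm =
      inj₁ (Kk , Eψ , proj₂ (den c k ψ σ v Kk Eψ (xi-down Kk X)) sm)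
    den-complete .(h ++ [ (y , φ) ]) ψ σ v
                 (inj₂ (inj₁ (h , y , φ , refl , ext@(Kh , _ , y∉h , _) , Eψ , y∉Vb))) X sm
      with extends-snoc⁻ h (xi-sound X)
    ... | ρ , s , _ , eh , _ , _ , refl =
      inj₂ (inj₁ (h , y , φ , ρ , s , refl , ext , Eψ , y∉Vb , refl ,
        proj₂ (den c h ψ ρ v Kh Eψ (proj₂ (xi c h ρ Kh) eh))
          (proj₁ (sem-drop-suffix ψ ρ [ (y , s) ] (fresh-last n s y∉h Eψ y∉Vb)) sm)))
    den-complete k ψ σ v (inj₂ (inj₂ (inj₁ (h , y , φ , refl , ext , refl)))) X y∈σ =
      inj₂ (inj₂ (inj₁ (h , y , φ , refl , ext , refl , y∈σ)))
    den-complete k ψ σ v (inj₂ (inj₂ (inj₂ (inj₁ (φ , φs , refl , Kk , Eφ , Es , ok))))) X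
                 (g , as , d , sφ , ss , refl) =
      inj₂ (inj₂ (inj₂ (inj₁ (φ , φs , refl , Kk , Eφ , Es , ok , g , as , d ,
        proj₂ (den c k φ σ g Kk Eφ Xk) sφ , proj₂ (denList-coherent Kk Xk φs as Es) ss , refl))))
      where Xk = xi-down Kk X
    den-complete k ψ σ v (inj₂ (inj₂ (inj₂ (inj₂ (inj₁ (f , φs , refl , Kk , Es , ok)))))) X
                 (as , a , ss , refl) =
      inj₂ (inj₂ (inj₂ (inj₂ (inj₁ (f , φs , refl , Kk , Es , ok , as , a ,
        proj₂ (denList-coherent Kk (xi-down Kk X) φs as Es) ss , refl)))))
    den-complete k ψ σ v (inj₂ (inj₂ (inj₂ (inj₂ (inj₂ (bs , φ , refl , Kk , wf@(_ , _ , ok , Eφ))))))) X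
                 (isSet , members) =
      inj₂ (inj₂ (inj₂ (inj₂ (inj₂ (bs , φ , refl , Kk , wf , isSet , λ z → ⇔-trans (members z)
        (⇔-sym (comprehension-coherent k bs φ σ z (binders-context n k bs Kk ok) Eφ (xi-sound X))))))))

  coherent : ∀ n → Coherent n
  coherent zero = record
    { xi  = λ { k σ refl → (λ { (_ , σ≡) → σ≡ }) , (λ σ≡ → refl , σ≡) }
    ; den = λ { k ψ σ v refl (_ , c , refl) (_ , refl) →
                  (λ { (_ , _ , _ , refl , v≡) → v≡ }) , (λ v≡ → refl , refl , c , refl , v≡) } }
  coherent (suc n) = record
    { xi  = λ k σ Kk → xi-sound , xi-complete k σ Kk
    ; den = λ k ψ σ v Kk Eψ X → den-sound k ψ σ v X , den-complete k ψ σ v Eψ X }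
    where open Step n (coherent n)

  Ξ⇒extends : ∀ {k σ} → Ξ k σ → Extends [] k σ
  Ξ⇒extends {k} {σ} (n , Kk , X) = proj₁ (xi (coherent n) k σ Kk) X

  extends⇒Xn : ∀ n {k σ} → Kn n k → Extends [] k σ → Xn n k σ
  extends⇒Xn n {k} {σ} Kk = proj₂ (xi (coherent n) k σ Kk)

  mean⇒sem : ∀ {k ψ σ v} → Ξ k σ → Mean k ψ σ v → Sem ψ σ v
  mean⇒sem {k} {ψ} {σ} {v} Ξσ (n , Kk , Eψ , D) =
    proj₁ (den (coherent n) k ψ σ v Kk Eψ (extends⇒Xn n Kk (Ξ⇒extends Ξσ))) D

  sem⇒Dn : ∀ n {k ψ σ v} → Kn n k → En n k ψ → Extends [] k σ → Sem ψ σ v → Dn n k ψ σ v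
  sem⇒Dn n {k} {ψ} {σ} {v} Kk Eψ e = proj₂ (den (coherent n) k ψ σ v Kk Eψ (extends⇒Xn n Kk e))

  K-mono : ∀ {n m k} → n ≤′ m → Kn n k → Kn m k
  K-mono (≤′-reflexive refl) Kk = Kk
  K-mono (≤′-step p) Kk = inj₁ (K-mono p Kk)

  E-mono : ∀ {n m k ψ} → n ≤′ m → Kn n k → En n k ψ → En m k ψ
  E-mono (≤′-reflexive refl) Kk Eψ = Eψ
  E-mono (≤′-step p) Kk Eψ = inj₁ (K-mono p Kk , E-mono p Kk Eψ)

  H-split : ∀ k a b → Hfrom k (a ++ b) → Hfrom (k ++ a) b
  H-split k [] b h = subst (λ r → Hfrom r b) (sym (++-identityʳ k)) h
  H-split k ((x , φ) ∷ a) b (_ , _ , _ , h) =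
    subst (λ r → Hfrom r b) (++-assoc k [ (x , φ) ] a) (H-split (k ++ [ (x , φ) ]) a b h)

  binder-extends-K : ∀ N {pre x φ} → Kn N pre → En N pre φ → ¬ x ∈ dom pre →
                     (∀ ρ → Ξ pre ρ → Σ[ v ∈ U ] (Mean pre φ ρ v × IsSet v)) →
                     KplusAt (stage N) pre x φ
  binder-extends-K N KN Eφ x∉pre sets = KN , Eφ , x∉pre , set-at-N
    where
    set-at-N : ∀ ρ → Xn N _ ρ → SetMeaning (stage N) _ _ ρ
    set-at-N ρ X with sets ρ (N , KN , X)
    ... | v , M , isSet = v , sem⇒Dn N KN Eφ (Ξ⇒extends (N , KN , X)) (mean⇒sem (N , KN , X) M) , isSet

  E-weaken : ∀ ψ pre post n → Kn n pre → En n pre ψ → Hfrom pre post →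
             Unique (dom (pre ++ post)) → All (λ b → ¬ Vb ψ (proj₁ b)) post →
             𝐄 (pre ++ post) ψ
  E-weaken ψ pre [] n Kp Eψ _ _ _ =
    n , subst (λ r → Kn n r × En n r ψ) (sym (++-identityʳ pre)) (Kp , Eψ)
  E-weaken ψ pre ((x , φ) ∷ post) n Kp Eψ (_ , (c , Kc , Eφ) , sets , h) uq (x∉Vb ∷ fresh) =
    subst (λ r → 𝐄 r ψ) (++-assoc pre [ (x , φ) ] post)
      (E-weaken ψ (pre ++ [ (x , φ) ]) post (suc N) (inj₂ (pre , x , φ , refl , extension)) Eψ⁺ h uq⁺ fresh)
    where
    N = n ⊔ c
    n≤N = ≤⇒≤′ (m≤m⊔n n c)
    x∉pre : ¬ x ∈ dom pre
    x∉pre x∈pre = unique-++-disjoint (dom pre) (subst Unique (dom-++ pre _) uq) x∈pre (here refl)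
    extension = binder-extends-K N (K-mono n≤N Kp) (E-mono (≤⇒≤′ (m≤n⊔m n c)) Kc Eφ) x∉pre sets
    Eψ⁺ = inj₂ (inj₁ (pre , x , φ , refl , extension , E-mono n≤N Kp Eψ , x∉Vb))
    uq⁺ = subst (λ r → Unique (dom r)) (sym (++-assoc pre [ (x , φ) ] post)) uq

  suffix-avoids : ∀ n ψ {ρ t} pre post → Unique (dom (pre ++ post)) → En n pre ψ →
                  All (λ b → ¬ Vb ψ (proj₁ b)) post → Extends ρ post t → Avoids (Occurs ψ) t
  suffix-avoids n ψ pre post uq Eψ fresh et y o y∈t
    with subst (y ∈_) (extends-dom post et) y∈t | occurs-declared n Eψ o
  ... | y∈post | inj₁ y∈pre = unique-++-disjoint (dom pre) (subst Unique (dom-++ pre post) uq) y∈pre y∈post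
  ... | y∈post | inj₂ y∈Vb with ∈-map⁻ proj₁ y∈post
  ...   | b , b∈post , refl = All.lookup fresh b∈post y∈Vb

  Restricts : Ctx → Ctx → Expr → Set
  Restricts pre k ψ = ∀ σ → Ξ k σ →
    Σ[ ρ ∈ Asg ] (Ξ pre ρ × ρ ⊑ σ × (∀ v → Mean k ψ σ v ⇔ Mean pre ψ ρ v))

  restrict-meaning : ∀ ψ pre post n → Kn n pre → En n pre ψ → Unique (dom (pre ++ post)) →
                     All (λ b → ¬ Vb ψ (proj₁ b)) post → 𝐄 (pre ++ post) ψ →
                     Restricts pre (pre ++ post) ψ
  restrict-meaning ψ pre post n Kp Eψ uq fresh (N , KN , EN) σ Ξσ
    with proj₁ (extends-++ [] pre post σ) (Ξ⇒extends Ξσ)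
  ... | ρ , t , eρ , et , refl = ρ , Ξρ , (t , refl) , λ v → restrict , extend
    where
    Ξρ : Ξ pre ρ
    Ξρ = n , Kp , extends⇒Xn n Kp eρ
    drop-t : ∀ {v} → Sem ψ (ρ ++ t) v ⇔ Sem ψ ρ v
    drop-t = sem-drop-suffix ψ ρ t (suffix-avoids n ψ pre post uq Eψ fresh et)
    restrict : ∀ {v} → Mean (pre ++ post) ψ (ρ ++ t) v → Mean pre ψ ρ v
    restrict M = n , Kp , Eψ , sem⇒Dn n Kp Eψ eρ (proj₁ drop-t (mean⇒sem Ξσ M))
    extend : ∀ {v} → Mean pre ψ ρ v → Mean (pre ++ post) ψ (ρ ++ t) v
    extend M = N , KN , EN , sem⇒Dn N KN EN (Ξ⇒extends Ξσ) (proj₂ drop-t (mean⇒sem Ξρ M))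

  weaken : ∀ ψ pre post → Unique (dom (pre ++ post)) → Hfrom pre post → 𝐄 pre ψ →
           All (λ b → ¬ Vb ψ (proj₁ b)) post →
           𝐄 (pre ++ post) ψ × Restricts pre (pre ++ post) ψ
  weaken ψ pre post uq h (n , Kp , Eψ) fresh =
    Eψ⁺ , restrict-meaning ψ pre post n Kp Eψ uq fresh Eψ⁺
    where Eψ⁺ = E-weaken ψ pre post n Kp Eψ h uq fresh

lemma3p15 : (𝓛 : Lang) → let open Theory 𝓛 in
    (bs : List (Var × Expr)) →
    1 ≤ length bs →
    Unique (map proj₁ bs) →
    All (λ b → 𝐄all (proj₂ b)) bs →
    H bs →
    (i : ℕ) → i < length bs →
    (ψ : Expr) → 𝐄 (take i bs) ψ →
    All (λ b → ¬ Vb ψ (proj₁ b)) (drop i bs) →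
    𝐄 bs ψ
    × (∀ σ → Ξ bs σ →
         Σ[ ρ ∈ Asg ] (Ξ (take i bs) ρ × ρ ⊑ σ
                       × (∀ v → Mean bs ψ σ v ⇔ Mean (take i bs) ψ ρ v)))
lemma3p15 𝓛 bs _ unique _ h i _ ψ Eψ fresh =
  subst (λ k → 𝐄 k ψ × Restricts (take i bs) k ψ) split
    (weaken ψ (take i bs) (drop i bs)
       (subst (Unique ∘ dom) (sym split) unique)
       (H-split [] (take i bs) (drop i bs) (subst H (sym split) h))
       Eψ fresh)
  where
  open Theory 𝓛
  open Weakening 𝓛
  split : take i bs ++ drop i bs ≡ bs
  split = take++drop≡id i bs
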